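{- Let $G$ be a graph and let $f_1,f_2,f_3$ be three distinct parallel edges of $G$. If $B(G)$ is a lattice path matroid, then $B(G+f)$ is a lattice path matroid, where $G+f$ is obtained by adding a new edge $f$ parallel to $f_1,f_2,f_3$. Moreover, if $B(G)$ has an interval ordering in which $f_1$ is the minimum (respectively, maximum) element, then $B(G+f)$ has an interval ordering in which $f_1$ is the minimum (respectively, maximum) element.
   Context: Graphs may have loops and parallel edges; parallel edges here are non-loop edges with the same two end vertices. $B(G)$ is the bicircular matroid: the matroid on $E(G)$ whose independent sets are edge sets $I$ such that each component of the subgraph formed by $I$ has at most one cycle (loops and parallel pairs count as cycles). A lattice path matroid is a matroid $M$ on $E$ for which there is a linear ordering of $E$ (an interval ordering) and a sequence of intervals of that ordering, pairwise incomparable under inclusion, such that $M$ is isomorphic to the transversal matroid presented by these intervals. -}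

module Defs where

open import Data.Nat using (ℕ; zero; suc; _+_)
open import Data.Bool using (Bool; true; false; if_then_else_)
open import Data.Fin using (Fin; zero; suc) renaming (_≤_ to _≤ᶠ_)
open import Data.Fin.Properties using (_≟_)
open import Data.Fin.Subset using (Subset; _∈_; _⊆_)
open import Data.List using (List; map; allFin)
open import Data.Nat.ListAction using (sum)
open import Data.Vec using (lookup)
open import Data.Product using (Σ; ∃; ∃-syntax; _×_; _,_; proj₁; proj₂; swap)
open import Data.Sum using (_⊎_)
open import Relation.Nullary using (¬_; does)
open import Relation.Binary.PropositionalEquality using (_≡_; _≢_)
open import Function.Bundles using (_↔_; Inverse)

-- A finite graph with loops and parallel edges allowed:
-- vertices Fin nV, edges Fin nE, each edge has two (unordered) ends.
-- An edge e is a loop iff both ends coincide.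
record Graph : Set where
  field
    nV   : ℕ
    nE   : ℕ
    ends : Fin nE → Fin nV × Fin nV
open Graph public

module _ (G : Graph) where

  end₁ end₂ : Fin (nE G) → Fin (nV G)
  end₁ e = proj₁ (ends G e)
  end₂ e = proj₂ (ends G e)

  IsLoop : Fin (nE G) → Set
  IsLoop e = end₁ e ≡ end₂ e

  SameEnds : Fin (nE G) → Fin (nE G) → Set
  SameEnds e e' = (ends G e ≡ ends G e') ⊎ (ends G e ≡ swap (ends G e'))

  Parallel : Fin (nE G) → Fin (nE G) → Set
  Parallel e e' = (¬ IsLoop e) × (¬ IsLoop e') × SameEnds e e'

  Incident : Fin (nV G) → Fin (nE G) → Set
  Incident v e = (end₁ e ≡ v) ⊎ (end₂ e ≡ v)

  endCount : Fin (nV G) → Fin (nE G) → ℕ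
  endCount v e = (if does (end₁ e ≟ v) then 1 else 0)
               + (if does (end₂ e ≟ v) then 1 else 0)

  deg : Subset (nE G) → Fin (nV G) → ℕ
  deg X v = sum (map (λ e → if lookup X e then endCount v e else 0) (allFin (nE G)))

  data Reach (X : Subset (nE G)) : Fin (nV G) → Fin (nV G) → Set where
    here  : ∀ {u} → Reach X u u
    step₁ : ∀ {u w} e → e ∈ X → end₁ e ≡ u → Reach X (end₂ e) w → Reach X u w
    step₂ : ∀ {u w} e → e ∈ X → end₂ e ≡ u → Reach X (end₁ e) w → Reach X u w

  -- a cycle: a nonempty, connected edge set in which every vertex it
  -- touches has degree exactly 2 (so loops and parallel pairs are cycles)
  IsCycle : Subset (nE G) → Set
  IsCycle C = (∃[ e ] e ∈ C)
            × (∀ v e → e ∈ C → Incident v e → deg C v ≡ 2)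
            × (∀ e e' → e ∈ C → e' ∈ C → Reach C (end₁ e) (end₁ e'))

  -- independent sets of the bicircular matroid B(G): every component of
  -- the subgraph formed by I contains at most one cycle
  BicircIndep : Subset (nE G) → Set
  BicircIndep I = ∀ C D → C ⊆ I → D ⊆ I → IsCycle C → IsCycle D →
                  (∃[ e ] ∃[ e' ] (e ∈ C × e' ∈ D × Reach I (end₁ e) (end₁ e'))) →
                  C ≡ D

-- A presentation by intervals of the linear order on positions Fin m:
-- r intervals [lo i, hi i].
Interval : ℕ → Set
Interval m = Fin m × Fin m

_⊆ᴵ_ : ∀ {m} → Interval m → Interval m → Set
(a , b) ⊆ᴵ (c , d) = (c ≤ᶠ a) × (b ≤ᶠ d)

_∈ᴵ_ : ∀ {m} → Fin m → Interval m → Set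
x ∈ᴵ (a , b) = (a ≤ᶠ x) × (x ≤ᶠ b)

-- I is a partial transversal of the family of intervals A (elements
-- located by the ordering σ): there is an injective assignment of the
-- elements of I to indices of intervals containing them.
PartialTransversal : ∀ {m r} → (Fin m → Fin m) → (Fin r → Interval m) → Subset m → Set
PartialTransversal {m} {r} σ A I =
  Σ (Fin m → Fin r) λ φ →
    (∀ x → x ∈ I → σ x ∈ᴵ A (φ x)) ×
    (∀ x y → x ∈ I → y ∈ I → φ x ≡ φ y → x ≡ y)

-- σ (sending each edge to its position) is an interval ordering of B(G):
-- there are intervals of the ordering, nonempty and pairwise incomparable
-- under inclusion, whose transversal matroid is B(G) (via σ).
IsIntervalOrdering : (G : Graph) → Fin (nE G) ↔ Fin (nE G) → Set
IsIntervalOrdering G σ =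
  ∃[ r ] Σ (Fin r → Interval (nE G)) λ A →
    (∀ i → proj₁ (A i) ≤ᶠ proj₂ (A i)) ×
    (∀ i j → i ≢ j → ¬ (A i ⊆ᴵ A j)) ×
    (∀ I → (BicircIndep G I → PartialTransversal (Inverse.to σ) A I)
         × (PartialTransversal (Inverse.to σ) A I → BicircIndep G I))

IsLatticePathBicircular : Graph → Set
IsLatticePathBicircular G = ∃[ σ ] IsIntervalOrdering G σ

HasIntervalOrderingWithMin : (G : Graph) → Fin (nE G) → Set
HasIntervalOrderingWithMin G e =
  ∃[ σ ] IsIntervalOrdering G σ × (∀ e' → Inverse.to σ e ≤ᶠ Inverse.to σ e')

HasIntervalOrderingWithMax : (G : Graph) → Fin (nE G) → Set
HasIntervalOrderingWithMax G e =
  ∃[ σ ] IsIntervalOrdering G σ × (∀ e' → Inverse.to σ e' ≤ᶠ Inverse.to σ e)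

-- G + f: add a new edge f (index zero) with the same ends as e;
-- old edge e' becomes suc e'.
addParallel : (G : Graph) → Fin (nE G) → Graph
addParallel G e = record { nV = nV G ; nE = suc (nE G) ; ends = ends' }
  where
    ends' : Fin (suc (nE G)) → Fin (nV G) × Fin (nV G)
    ends' zero = ends G e
    ends' (suc e') = ends G e'

-- In B(G) any two of the parallel edges f₁, f₂, f₃ form an independent set (a single
-- cycle) while all three do not. Reading this through an interval presentation, the sets
-- of intervals containing f₁, f₂, f₃ admit distinct representatives pairwise but not
-- jointly, so they all lie inside a two-element set {j, k} of intervals and one of the
-- edges, the pivot, lies in both j and k. Insert f directly after (or before) the pivot
-- and double the pivot's position in every interval: then f lies in exactly the intervals
-- of the pivot. An independent set containing f but not the pivot corresponds to the set
-- with f replaced by the pivot, on both sides. If the pivot is present as well, f can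
-- take the role of whichever fᵢ is absent: every interval of fᵢ is j or k, hence an
-- interval of the pivot, and when f is matched to an interval not containing fᵢ,
-- exchanging the intervals of f and of the pivot repairs this. Inserting f after (before)
-- the pivot keeps f₁ minimal (maximal).

module Submission where

open import Data.Nat as ℕ using (ℕ; zero; suc; _+_; z≤n; s≤s)
import Data.Nat.Properties as ℕ
open import Data.Bool using (true; false; if_then_else_)
open import Data.Fin using (Fin; zero; suc; punchIn; inject₁; _≤_)
open import Data.Fin.Properties using (_≟_; _≤?_; ≤-refl; ≤-trans; punchInᵢ≢i; punchIn-mono-≤; punchIn-cancel-≤; i≤inject₁[j]⇒i≤1+j)
open import Data.Fin.Permutation using (insert)
open import Data.Fin.Permutation.Components using (transpose; transpose-inverse)
open import Data.Fin.Subset using (Subset; _∈_; _∉_; _⊆_; ⁅_⁆; _∪_; _∩_)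
open import Data.Fin.Subset.Properties using (_∈?_; drop-there; out⊆; ⊆-antisym; x∈p∩q⁺; x∈p∩q⁻; x∈⁅x⁆; x∈⁅y⁆⇒x≡y; x∈p∪q⁻; x∈p∪q⁺)
import Data.List as List
import Data.List.Properties as List
open import Data.Nat.ListAction using (sum)
open import Data.Vec using (lookup; _∷_; here; there)
open import Data.Vec.Properties using ([]=⇒lookup; lookup⇒[]=)
open import Data.Product using (Σ; ∃-syntax; _×_; _,_; proj₁; proj₂; swap)
open import Data.Sum as Sum using (_⊎_; inj₁; inj₂; [_,_])
open import Data.Empty using (⊥-elim)
open import Relation.Nullary using (¬_; does; yes; no; _×-dec_)
open import Relation.Nullary.Decidable using (dec-true; dec-false)
open import Relation.Unary using (Decidable)
open import Relation.Binary.PropositionalEquality using (_≡_; _≢_; refl; sym; trans; cong; cong₂; subst; subst₂; module ≡-Reasoning)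
open import Function using (_∘_; id)
open import Function.Bundles using (_⇔_; mk⇔; Equivalence; _↔_; Inverse)
open import Function.Construct.Composition using (_⇔-∘_)
open import Function.Properties.Equivalence using (⇔-setoid)
import Relation.Binary.Reasoning.Setoid as SetoidReasoning
open import Level using (0ℓ)
open import Algebra.Properties.CommutativeMonoid.Sum ℕ.+-0-commutativeMonoid
  using (∑-distrib-+; sum-remove; sum-cong-≗; sum-replicate-zero)
  renaming (sum to ∑)
open import Defs

∑-single : ∀ {n} (F : Fin n → ℕ) e → (∀ x → x ≢ e → F x ≡ 0) → ∑ F ≡ F e
∑-single {suc n} F e F≡0 = begin
  ∑ F                                  ≡⟨ sum-remove {i = e} F ⟩
  F e + ∑ {n} (λ j → F (punchIn e j))  ≡⟨ cong (F e +_) (sum-cong-≗ {n} (λ j → F≡0 _ (punchInᵢ≢i e j))) ⟩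
  F e + ∑ {n} (λ _ → 0)                ≡⟨ cong (F e +_) (sum-replicate-zero n) ⟩
  F e + 0                              ≡⟨ ℕ.+-identityʳ (F e) ⟩
  F e                                  ∎
  where open ≡-Reasoning

∑-list : ∀ {n} (F : Fin n → ℕ) → sum (List.tabulate F) ≡ ∑ F
∑-list {zero} F = refl
∑-list {suc n} F = cong (F zero +_) (∑-list (F ∘ suc))

module _ {n : ℕ} where

  pair : Fin n → Fin n → Subset n
  pair a b = ⁅ a ⁆ ∪ ⁅ b ⁆

  ∈-pair⁺ˡ : ∀ (a b : Fin n) → a ∈ pair a b
  ∈-pair⁺ˡ a b = x∈p∪q⁺ (inj₁ (x∈⁅x⁆ a))

  ∈-pair⁺ʳ : ∀ (a b : Fin n) → b ∈ pair a b
  ∈-pair⁺ʳ a b = x∈p∪q⁺ {p = ⁅ a ⁆} (inj₂ (x∈⁅x⁆ b))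

  ∈-pair⁻ : ∀ {a b x : Fin n} → x ∈ pair a b → x ≡ a ⊎ x ≡ b
  ∈-pair⁻ {a} {b} x∈ab with x∈p∪q⁻ ⁅ a ⁆ ⁅ b ⁆ x∈ab
  ... | inj₁ x∈a = inj₁ (x∈⁅y⁆⇒x≡y a x∈a)
  ... | inj₂ x∈b = inj₂ (x∈⁅y⁆⇒x≡y b x∈b)

  pair-⊆ : ∀ {a b : Fin n} {X} → a ∈ X → b ∈ X → pair a b ⊆ X
  pair-⊆ a∈X b∈X x∈ab with ∈-pair⁻ x∈ab
  ... | inj₁ refl = a∈X
  ... | inj₂ refl = b∈X

  triple : Fin n → Fin n → Fin n → Subset n
  triple a b c = ⁅ a ⁆ ∪ pair b c

  ∈-triple⁻ : ∀ {a b c x : Fin n} → x ∈ triple a b c → x ≡ a ⊎ x ≡ b ⊎ x ≡ c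
  ∈-triple⁻ {a} {b} {c} x∈abc with x∈p∪q⁻ ⁅ a ⁆ (pair b c) x∈abc
  ... | inj₁ x∈a  = inj₁ (x∈⁅y⁆⇒x≡y a x∈a)
  ... | inj₂ x∈bc = inj₂ (∈-pair⁻ x∈bc)

  ∈-triple⁺ : ∀ {a b c x : Fin n} → x ≡ a ⊎ x ≡ b ⊎ x ≡ c → x ∈ triple a b c
  ∈-triple⁺ (inj₁ refl)        = x∈p∪q⁺ (inj₁ (x∈⁅x⁆ _))
  ∈-triple⁺ {a} (inj₂ (inj₁ refl)) = x∈p∪q⁺ {p = ⁅ a ⁆} (inj₂ (∈-pair⁺ˡ _ _))
  ∈-triple⁺ {a} (inj₂ (inj₂ refl)) = x∈p∪q⁺ {p = ⁅ a ⁆} (inj₂ (∈-pair⁺ʳ _ _))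

module _ (G : Graph) where

  weight : Subset (nE G) → Fin (nV G) → Fin (nE G) → ℕ
  weight X v e = if lookup X e then endCount G v e else 0

  weight-∈ : ∀ {X v e} → e ∈ X → weight X v e ≡ endCount G v e
  weight-∈ e∈X rewrite []=⇒lookup e∈X = refl

  weight-∉ : ∀ {X v e} → e ∉ X → weight X v e ≡ 0
  weight-∉ {X} {v} {e} e∉X with lookup X e in eq
  ... | false = refl
  ... | true  = ⊥-elim (e∉X (lookup⇒[]= e X eq))

  deg≡∑ : ∀ X v → deg G X v ≡ ∑ (weight X v)
  deg≡∑ X v = trans (cong sum (List.map-tabulate id (weight X v))) (∑-list (weight X v))

  deg-⁅⁆ : ∀ e v → deg G ⁅ e ⁆ v ≡ endCount G v e
  deg-⁅⁆ e v = begin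
    deg G ⁅ e ⁆ v        ≡⟨ deg≡∑ ⁅ e ⁆ v ⟩
    ∑ (weight ⁅ e ⁆ v)   ≡⟨ ∑-single (weight ⁅ e ⁆ v) e (λ x x≢e → weight-∉ (x≢e ∘ x∈⁅y⁆⇒x≡y e)) ⟩
    weight ⁅ e ⁆ v e     ≡⟨ weight-∈ (x∈⁅x⁆ e) ⟩
    endCount G v e       ∎
    where open ≡-Reasoning

  deg-∪ : ∀ {X Y} → (∀ {e} → e ∈ X → e ∉ Y) → ∀ v → deg G (X ∪ Y) v ≡ deg G X v + deg G Y v
  deg-∪ {X} {Y} disjoint v = begin
    deg G (X ∪ Y) v                         ≡⟨ deg≡∑ (X ∪ Y) v ⟩
    ∑ (weight (X ∪ Y) v)                    ≡⟨ sum-cong-≗ weight-split ⟩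
    ∑ (λ e → weight X v e + weight Y v e)   ≡⟨ ∑-distrib-+ (weight X v) (weight Y v) ⟩
    ∑ (weight X v) + ∑ (weight Y v)         ≡⟨ sym (cong₂ _+_ (deg≡∑ X v) (deg≡∑ Y v)) ⟩
    deg G X v + deg G Y v                   ∎
    where
    open ≡-Reasoning
    weight-split : ∀ e → weight (X ∪ Y) v e ≡ weight X v e + weight Y v e
    weight-split e with e ∈? X | e ∈? Y
    ... | yes e∈X | _ = begin
      weight (X ∪ Y) v e            ≡⟨ weight-∈ (x∈p∪q⁺ (inj₁ e∈X)) ⟩
      endCount G v e                ≡⟨ sym (ℕ.+-identityʳ _) ⟩
      endCount G v e + 0            ≡⟨ sym (cong₂ _+_ (weight-∈ e∈X) (weight-∉ (disjoint e∈X))) ⟩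
      weight X v e + weight Y v e   ∎
    ... | no e∉X | yes e∈Y = trans (weight-∈ (x∈p∪q⁺ {p = X} (inj₂ e∈Y))) (sym (cong₂ _+_ (weight-∉ e∉X) (weight-∈ e∈Y)))
    ... | no e∉X | no e∉Y = trans (weight-∉ ([ e∉X , e∉Y ] ∘ x∈p∪q⁻ X Y)) (sym (cong₂ _+_ (weight-∉ e∉X) (weight-∉ e∉Y)))

  reach-trans : ∀ {X u w z} → Reach G X u w → Reach G X w z → Reach G X u z
  reach-trans here           q = q
  reach-trans (step₁ e x p r) q = step₁ e x p (reach-trans r q)
  reach-trans (step₂ e x p r) q = step₂ e x p (reach-trans r q)

  reach-edge : ∀ {X e} → e ∈ X → Reach G X (end₁ G e) (end₂ G e)
  reach-edge e∈X = step₁ _ e∈X refl here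

  reach-edge⁻ : ∀ {X e} → e ∈ X → Reach G X (end₂ G e) (end₁ G e)
  reach-edge⁻ e∈X = step₂ _ e∈X refl here

  reach-sym : ∀ {X u w} → Reach G X u w → Reach G X w u
  reach-sym here                 = here
  reach-sym (step₁ e x refl r) = reach-trans (reach-sym r) (reach-edge⁻ x)
  reach-sym (step₂ e x refl r) = reach-trans (reach-sym r) (reach-edge x)

  reach-mono : ∀ {X Y u w} → X ⊆ Y → Reach G X u w → Reach G Y u w
  reach-mono X⊆Y here            = here
  reach-mono X⊆Y (step₁ e x p r) = step₁ e (X⊆Y x) p (reach-mono X⊆Y r)
  reach-mono X⊆Y (step₂ e x p r) = step₂ e (X⊆Y x) p (reach-mono X⊆Y r)

  bicircIndep-mono : ∀ {X Y} → Y ⊆ X → BicircIndep G X → BicircIndep G Y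
  bicircIndep-mono Y⊆X indep C D C⊆Y D⊆Y C-cyc D-cyc (e , e′ , e∈C , e′∈D , r) =
    indep C D (Y⊆X ∘ C⊆Y) (Y⊆X ∘ D⊆Y) C-cyc D-cyc (e , e′ , e∈C , e′∈D , reach-mono Y⊆X r)

  sameEnds-sym : ∀ {a b} → SameEnds G a b → SameEnds G b a
  sameEnds-sym (inj₁ eq) = inj₁ (sym eq)
  sameEnds-sym (inj₂ eq) = inj₂ (cong swap (sym eq))

  endCount-sameEnds : ∀ {a b} → SameEnds G a b → ∀ v → endCount G v a ≡ endCount G v b
  endCount-sameEnds {b = b} a∥b v =
    [ cong count , (λ eq → trans (cong count eq) (ℕ.+-comm (hit (end₂ G b)) (hit (end₁ G b)))) ] a∥b
    where
    hit : Fin (nV G) → ℕ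
    hit x = if does (x ≟ v) then 1 else 0
    count : Fin (nV G) × Fin (nV G) → ℕ
    count p = hit (proj₁ p) + hit (proj₂ p)

  incident-sameEnds : ∀ {a b v} → SameEnds G a b → Incident G v a → Incident G v b
  incident-sameEnds (inj₁ eq) (inj₁ p) = inj₁ (trans (cong proj₁ (sym eq)) p)
  incident-sameEnds (inj₁ eq) (inj₂ p) = inj₂ (trans (cong proj₂ (sym eq)) p)
  incident-sameEnds (inj₂ eq) (inj₁ p) = inj₂ (trans (cong proj₁ (sym eq)) p)
  incident-sameEnds (inj₂ eq) (inj₂ p) = inj₁ (trans (cong proj₂ (sym eq)) p)

  reach-sameEnds : ∀ {X a b} → SameEnds G a b → b ∈ X → Reach G X (end₁ G a) (end₂ G a)
  reach-sameEnds (inj₁ eq) b∈X = subst₂ (Reach G _) (cong proj₁ (sym eq)) (cong proj₂ (sym eq)) (reach-edge b∈X)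
  reach-sameEnds (inj₂ eq) b∈X = subst₂ (Reach G _) (cong proj₁ (sym eq)) (cong proj₂ (sym eq)) (reach-edge⁻ b∈X)

  reach-end₁-sameEnds : ∀ {X a b} → SameEnds G a b → b ∈ X → Reach G X (end₁ G b) (end₁ G a)
  reach-end₁-sameEnds (inj₁ eq) b∈X = subst (Reach G _ _) (cong proj₁ (sym eq)) here
  reach-end₁-sameEnds (inj₂ eq) b∈X = subst (Reach G _ _) (cong proj₁ (sym eq)) (reach-edge b∈X)

  endCount-nonLoop : ∀ {a v} → ¬ IsLoop G a → Incident G v a → endCount G v a ≡ 1
  endCount-nonLoop {a} {v} nonLoop inc with end₁ G a ≟ v | end₂ G a ≟ v | inc
  ... | yes p | yes q | _      = ⊥-elim (nonLoop (trans p (sym q)))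
  ... | yes _ | no  _ | _      = refl
  ... | no  _ | yes _ | _      = refl
  ... | no  p | no  _ | inj₁ r = ⊥-elim (p r)
  ... | no  _ | no  q | inj₂ r = ⊥-elim (q r)

  deg-pair : ∀ {a b} → a ≢ b → ∀ v → deg G (pair a b) v ≡ endCount G v a + endCount G v b
  deg-pair {a} {b} a≢b v =
    trans (deg-∪ (λ {x} x∈a x∈b → a≢b (trans (sym (x∈⁅y⁆⇒x≡y a x∈a)) (x∈⁅y⁆⇒x≡y b x∈b))) v)
          (cong₂ _+_ (deg-⁅⁆ a v) (deg-⁅⁆ b v))

  pair-isCycle : ∀ {a b} → Parallel G a b → a ≢ b → IsCycle G (pair a b)
  pair-isCycle {a} {b} (a-nonLoop , b-nonLoop , a∥b) a≢b = (a , ∈-pair⁺ˡ a b) , degree-two , connected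
    where
    degree-two : ∀ v e → e ∈ pair a b → Incident G v e → deg G (pair a b) v ≡ 2
    degree-two v e e∈ab inc with ∈-pair⁻ e∈ab
    ... | inj₁ refl = trans (deg-pair a≢b v)
      (cong₂ _+_ (endCount-nonLoop a-nonLoop inc) (endCount-nonLoop b-nonLoop (incident-sameEnds a∥b inc)))
    ... | inj₂ refl = trans (deg-pair a≢b v)
      (cong₂ _+_ (endCount-nonLoop a-nonLoop (incident-sameEnds (sameEnds-sym a∥b) inc)) (endCount-nonLoop b-nonLoop inc))
    from-a : ∀ {x} → x ∈ pair a b → Reach G (pair a b) (end₁ G a) (end₁ G x)
    from-a x∈ab with ∈-pair⁻ x∈ab
    ... | inj₁ refl = here
    ... | inj₂ refl = reach-end₁-sameEnds (sameEnds-sym a∥b) (∈-pair⁺ˡ a b)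
    connected : ∀ x y → x ∈ pair a b → y ∈ pair a b → Reach G (pair a b) (end₁ G x) (end₁ G y)
    connected x y x∈ab y∈ab = reach-trans (reach-sym (from-a x∈ab)) (from-a y∈ab)

  ⁅⁆-¬isCycle : ∀ {a} → ¬ IsLoop G a → ¬ IsCycle G ⁅ a ⁆
  ⁅⁆-¬isCycle {a} nonLoop (_ , degree-two , _) with
    trans (sym (endCount-nonLoop nonLoop (inj₁ refl))) (trans (sym (deg-⁅⁆ a (end₁ G a))) (degree-two (end₁ G a) a (x∈⁅x⁆ a) (inj₁ refl)))
  ... | ()

  cycle-⊆-pair : ∀ {a b C} → Parallel G a b → C ⊆ pair a b → IsCycle G C → C ≡ pair a b
  cycle-⊆-pair {a} {b} {C} (a-nonLoop , b-nonLoop , _) C⊆ab C-cyc@((e , e∈C) , _) =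
    ⊆-antisym C⊆ab (pair-⊆ a∈C b∈C)
    where
    partner : ∀ {x y} → ¬ IsLoop G x → (∀ {e} → e ∈ C → e ≡ x ⊎ e ≡ y) → x ∈ C → y ∈ C
    partner {x} {y} nonLoop C⊆xy x∈C with y ∈? C
    ... | yes y∈C = y∈C
    ... | no  y∉C = ⊥-elim (⁅⁆-¬isCycle nonLoop (subst (IsCycle G) (⊆-antisym C⊆x x⊆C) C-cyc))
      where
      C⊆x : C ⊆ ⁅ x ⁆
      C⊆x z∈C with C⊆xy z∈C
      ... | inj₁ refl = x∈⁅x⁆ x
      ... | inj₂ refl = ⊥-elim (y∉C z∈C)
      x⊆C : ⁅ x ⁆ ⊆ C
      x⊆C z∈x rewrite x∈⁅y⁆⇒x≡y x z∈x = x∈C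
    C⊆ab⁻ : ∀ {e} → e ∈ C → e ≡ a ⊎ e ≡ b
    C⊆ab⁻ = ∈-pair⁻ ∘ C⊆ab
    C⊆ba⁻ : ∀ {e} → e ∈ C → e ≡ b ⊎ e ≡ a
    C⊆ba⁻ = Sum.swap ∘ C⊆ab⁻
    a∈C×b∈C : a ∈ C × b ∈ C
    a∈C×b∈C with C⊆ab⁻ e∈C
    ... | inj₁ refl = e∈C , partner a-nonLoop C⊆ab⁻ e∈C
    ... | inj₂ refl = partner b-nonLoop C⊆ba⁻ e∈C , e∈C
    a∈C : a ∈ C
    a∈C = proj₁ a∈C×b∈C
    b∈C : b ∈ C
    b∈C = proj₂ a∈C×b∈C

  pair-bicircIndep : ∀ {a b} → Parallel G a b → BicircIndep G (pair a b)
  pair-bicircIndep a∥b C D C⊆ab D⊆ab C-cyc D-cyc _ =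
    trans (cycle-⊆-pair a∥b C⊆ab C-cyc) (sym (cycle-⊆-pair a∥b D⊆ab D-cyc))

  triple-¬bicircIndep : ∀ {a b c I} → a ≢ b → a ≢ c → b ≢ c → Parallel G a b → Parallel G a c →
                        a ∈ I → b ∈ I → c ∈ I → ¬ BicircIndep G I
  triple-¬bicircIndep {a} {b} {c} a≢b a≢c b≢c a∥b a∥c a∈I b∈I c∈I indep = ab≢ac
    (indep (pair a b) (pair a c) (pair-⊆ a∈I b∈I) (pair-⊆ a∈I c∈I)
           (pair-isCycle a∥b a≢b) (pair-isCycle a∥c a≢c) (a , a , ∈-pair⁺ˡ a b , ∈-pair⁺ˡ a c , here))
    where
    ab≢ac : pair a b ≢ pair a c
    ab≢ac eq with ∈-pair⁻ (subst (b ∈_) eq (∈-pair⁺ʳ a b))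
    ... | inj₁ b≡a = a≢b (sym b≡a)
    ... | inj₂ b≡c = b≢c b≡c

-- Matchings

transpose-cases : ∀ {m} (x y z : Fin m) →
  (z ≡ x × transpose x y z ≡ y) ⊎ (z ≡ y × transpose x y z ≡ x) ⊎ (z ≢ x × z ≢ y × transpose x y z ≡ z)
transpose-cases x y z with z ≟ x
... | yes z≡x = inj₁ (z≡x , refl)
... | no  z≢x with z ≟ y
...   | yes z≡y = inj₂ (inj₁ (z≡y , refl))
...   | no  z≢y = inj₂ (inj₂ (z≢x , z≢y , refl))

Matching : ∀ {m r} → (Fin m → Fin r → Set) → Subset m → Set
Matching {m} {r} R I =
  Σ (Fin m → Fin r) λ φ → (∀ x → x ∈ I → R x (φ x)) × (∀ x y → x ∈ I → y ∈ I → φ x ≡ φ y → x ≡ y)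

module _ {m r} {R : Fin m → Fin r → Set} where

  matching-weaken : ∀ {S I} → (∀ {x j} → x ∈ I → R x j → S x j) → Matching R I → Matching S I
  matching-weaken R⇒S (φ , matched , injective) = φ , (λ x x∈I → R⇒S x∈I (matched x x∈I)) , injective

  matching-mono : ∀ {I J} → J ⊆ I → Matching R I → Matching R J
  matching-mono J⊆I (φ , matched , injective) =
    φ , (λ x → matched x ∘ J⊆I) , (λ x y x∈J y∈J → injective x y (J⊆I x∈J) (J⊆I y∈J))

  matching-retarget : ∀ {S I x} ((φ , _) : Matching R I) → S x (φ x) →
                      (∀ {z j} → z ∈ I → z ≢ x → R z j → S z j) → Matching S I
  matching-retarget {S} {I} {x} (φ , matched , injective) Sxφx R⇒S = φ , matched′ , injective
    where
    matched′ : ∀ z → z ∈ I → S z (φ z)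
    matched′ z z∈I with z ≟ x
    ... | yes refl = Sxφx
    ... | no  z≢x  = R⇒S z∈I z≢x (matched z z∈I)

  triple-matching : ∀ {a b c p q s} → a ≢ b → a ≢ c → b ≢ c → R a p → R b q → R c s →
                    p ≢ q → p ≢ s → q ≢ s → Matching R (triple a b c)
  triple-matching {a} {b} {c} {p} {q} {s} a≢b a≢c b≢c Rap Rbq Rcs p≢q p≢s q≢s = φ , matched , injective
    where
    φ : Fin m → Fin r
    φ x = if does (x ≟ a) then p else if does (x ≟ b) then q else s
    φ-a : φ a ≡ p
    φ-a rewrite dec-true (a ≟ a) refl = refl
    φ-b : φ b ≡ q
    φ-b rewrite dec-false (b ≟ a) (a≢b ∘ sym) | dec-true (b ≟ b) refl = refl
    φ-c : φ c ≡ s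
    φ-c rewrite dec-false (c ≟ a) (a≢c ∘ sym) | dec-false (c ≟ b) (b≢c ∘ sym) = refl
    matched : ∀ x → x ∈ triple a b c → R x (φ x)
    matched x x∈abc with ∈-triple⁻ x∈abc
    ... | inj₁ refl        = subst (R x) (sym φ-a) Rap
    ... | inj₂ (inj₁ refl) = subst (R x) (sym φ-b) Rbq
    ... | inj₂ (inj₂ refl) = subst (R x) (sym φ-c) Rcs
    injective : ∀ x y → x ∈ triple a b c → y ∈ triple a b c → φ x ≡ φ y → x ≡ y
    injective x y x∈abc y∈abc eq with ∈-triple⁻ x∈abc | ∈-triple⁻ y∈abc
    ... | inj₁ refl        | inj₁ refl        = refl
    ... | inj₂ (inj₁ refl) | inj₂ (inj₁ refl) = refl
    ... | inj₂ (inj₂ refl) | inj₂ (inj₂ refl) = refl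
    ... | inj₁ refl        | inj₂ (inj₁ refl) = ⊥-elim (p≢q (trans (sym φ-a) (trans eq φ-b)))
    ... | inj₁ refl        | inj₂ (inj₂ refl) = ⊥-elim (p≢s (trans (sym φ-a) (trans eq φ-c)))
    ... | inj₂ (inj₁ refl) | inj₁ refl        = ⊥-elim (p≢q (trans (sym φ-a) (trans (sym eq) φ-b)))
    ... | inj₂ (inj₁ refl) | inj₂ (inj₂ refl) = ⊥-elim (q≢s (trans (sym φ-b) (trans eq φ-c)))
    ... | inj₂ (inj₂ refl) | inj₁ refl        = ⊥-elim (p≢s (trans (sym φ-a) (trans (sym eq) φ-c)))
    ... | inj₂ (inj₂ refl) | inj₂ (inj₁ refl) = ⊥-elim (q≢s (trans (sym φ-b) (trans (sym eq) φ-c)))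

  matching-exchange : ∀ {S I x y} ((φ , _) : Matching R I) → x ∈ I → y ∈ I → S x (φ y) → S y (φ x) →
                      (∀ {z j} → z ∈ I → z ≢ x → z ≢ y → R z j → S z j) → Matching S I
  matching-exchange {S} {I} {x} {y} (φ , matched , injective) x∈I y∈I Sxφy Syφx R⇒S =
    φ ∘ transpose x y , matched′ , injective′
    where
    transpose-∈ : ∀ {z} → z ∈ I → transpose x y z ∈ I
    transpose-∈ {z} z∈I with transpose-cases x y z
    ... | inj₁ (_ , eq)            = subst (_∈ I) (sym eq) y∈I
    ... | inj₂ (inj₁ (_ , eq))     = subst (_∈ I) (sym eq) x∈I
    ... | inj₂ (inj₂ (_ , _ , eq)) = subst (_∈ I) (sym eq) z∈I
    matched′ : ∀ z → z ∈ I → S z (φ (transpose x y z))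
    matched′ z z∈I with transpose-cases x y z
    ... | inj₁ (refl , eq)              = subst (S z ∘ φ) (sym eq) Sxφy
    ... | inj₂ (inj₁ (refl , eq))       = subst (S z ∘ φ) (sym eq) Syφx
    ... | inj₂ (inj₂ (z≢x , z≢y , eq)) = R⇒S z∈I z≢x z≢y (subst (R z ∘ φ) (sym eq) (matched z z∈I))
    injective′ : ∀ z w → z ∈ I → w ∈ I → φ (transpose x y z) ≡ φ (transpose x y w) → z ≡ w
    injective′ z w z∈I w∈I eq = begin
      z                               ≡⟨ transpose-inverse y x ⟨
      transpose y x (transpose x y z) ≡⟨ cong (transpose y x) (injective _ _ (transpose-∈ z∈I) (transpose-∈ w∈I) eq) ⟩
      transpose y x (transpose x y w) ≡⟨ transpose-inverse y x ⟩
      w                               ∎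
      where open ≡-Reasoning

module _ {m n r} {S : Fin n → Fin r → Set} {X : Subset m} {Y : Subset n} (u : Fin m → Fin n) where

  matching-comap : (∀ {x} → x ∈ X → u x ∈ Y) → (∀ {x y} → x ∈ X → y ∈ X → u x ≡ u y → x ≡ y) →
                   Matching S Y → Matching (S ∘ u) X
  matching-comap u-∈ u-injective (φ , matched , injective) =
    φ ∘ u , (λ x x∈X → matched (u x) (u-∈ x∈X)) ,
    (λ x y x∈X y∈X eq → u-injective x∈X y∈X (injective _ _ (u-∈ x∈X) (u-∈ y∈X) eq))

  matching-map : (w : Fin n → Fin m) → (∀ {y} → y ∈ Y → w y ∈ X) → (∀ y → u (w y) ≡ y) →
                 Matching (S ∘ u) X → Matching S Y
  matching-map w w-∈ u∘w≡id (φ , matched , injective) =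
    φ ∘ w , (λ y y∈Y → subst (λ z → S z (φ (w y))) (u∘w≡id y) (matched (w y) (w-∈ y∈Y))) ,
    (λ y y′ y∈Y y′∈Y eq → trans (sym (u∘w≡id y)) (trans (cong u (injective _ _ (w-∈ y∈Y) (w-∈ y′∈Y) eq)) (u∘w≡id y′)))

-- Collapsing the new edge onto an old one

-- Separated X′ says that collapsing the new edge zero onto g is injective on X′.
module Relabel {n} (g : Fin n) where

  old : Fin (suc n) → Fin n
  old zero    = g
  old (suc e) = e

  image : Subset (suc n) → Subset n
  image (false ∷ X) = X
  image (true  ∷ X) = ⁅ g ⁆ ∪ X

  section : Subset (suc n) → Fin n → Fin (suc n)
  section (false ∷ X) e = suc e
  section (true  ∷ X) e with e ≟ g
  ... | yes _ = zero
  ... | no  _ = suc e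

  preimage : Subset n → Subset (suc n)
  preimage C = lookup C g ∷ C

  Separated : Subset (suc n) → Set
  Separated X′ = zero ∈ X′ → suc g ∉ X′

  ∈-image⁺ : ∀ {X′ e} → e ∈ X′ → old e ∈ image X′
  ∈-image⁺ {true  ∷ X} here         = x∈p∪q⁺ (inj₁ (x∈⁅x⁆ g))
  ∈-image⁺ {true  ∷ X} (there e∈X) = x∈p∪q⁺ {p = ⁅ g ⁆} (inj₂ e∈X)
  ∈-image⁺ {false ∷ X} (there e∈X) = e∈X

  old-section : ∀ X′ e → old (section X′ e) ≡ e
  old-section (false ∷ X) e = refl
  old-section (true  ∷ X) e with e ≟ g
  ... | yes e≡g = sym e≡g
  ... | no  _   = refl

  section-∈ : ∀ {X′ e} → e ∈ image X′ → section X′ e ∈ X′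
  section-∈ {false ∷ X} e∈X = there e∈X
  section-∈ {true  ∷ X} {e} e∈gX with e ≟ g
  ... | yes _   = here
  ... | no  e≢g = there ([ ⊥-elim ∘ e≢g ∘ x∈⁅y⁆⇒x≡y g , id ] (x∈p∪q⁻ ⁅ g ⁆ X e∈gX))

  old-injectiveOn : ∀ {X′ x y} → Separated X′ → x ∈ X′ → y ∈ X′ → old x ≡ old y → x ≡ y
  old-injectiveOn {x = zero}  {zero}  sep _   _   _    = refl
  old-injectiveOn {x = zero}  {suc y} sep x∈X y∈X refl = ⊥-elim (sep x∈X y∈X)
  old-injectiveOn {x = suc x} {zero}  sep x∈X y∈X refl = ⊥-elim (sep y∈X x∈X)
  old-injectiveOn {x = suc x} {suc y} sep _   _   refl = refl

  ∈-preimage⁺ : ∀ {C e} → old e ∈ C → e ∈ preimage C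
  ∈-preimage⁺ {C} {zero}  g∈C = subst (λ b → zero ∈ b ∷ C) (sym ([]=⇒lookup g∈C)) here
  ∈-preimage⁺ {C} {suc e} e∈C = there e∈C

  ∈-preimage⁻ : ∀ {C e} → e ∈ preimage C → old e ∈ C
  ∈-preimage⁻ {C} {zero}  g∈C = lookup⇒[]= g C ([]=⇒lookup g∈C)
  ∈-preimage⁻ {C} {suc e} (there e∈C) = e∈C

  image-mono : ∀ {X′ Y′} → X′ ⊆ Y′ → image X′ ⊆ image Y′
  image-mono {X′} {Y′} X⊆Y {e} e∈X = subst (_∈ image Y′) (old-section X′ e) (∈-image⁺ (X⊆Y (section-∈ e∈X)))

  separated-mono : ∀ {X′ Y′} → X′ ⊆ Y′ → Separated Y′ → Separated X′
  separated-mono X⊆Y sep z∈X g∈X = sep (X⊆Y z∈X) (X⊆Y g∈X)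

  image-restrict : ∀ {I′ C} → C ⊆ image I′ → image (I′ ∩ preimage C) ≡ C
  image-restrict {I′} {C} C⊆I = ⊆-antisym to from
    where
    to : image (I′ ∩ preimage C) ⊆ C
    to {e} e∈ = subst (_∈ C) (old-section (I′ ∩ preimage C) e)
                  (∈-preimage⁻ (proj₂ (x∈p∩q⁻ I′ (preimage C) (section-∈ e∈))))
    from : C ⊆ image (I′ ∩ preimage C)
    from {e} e∈C = subst (_∈ image (I′ ∩ preimage C)) (old-section I′ e)
      (∈-image⁺ (x∈p∩q⁺ (section-∈ {I′} (C⊆I e∈C) , ∈-preimage⁺ (subst (_∈ C) (sym (old-section I′ e)) e∈C))))

  restrict-image : ∀ {I′ C′} → Separated I′ → C′ ⊆ I′ → I′ ∩ preimage (image C′) ≡ C′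
  restrict-image {I′} {C′} sep C⊆I = ⊆-antisym to from
    where
    to : I′ ∩ preimage (image C′) ⊆ C′
    to {e} e∈ with x∈p∩q⁻ I′ (preimage (image C′)) e∈
    ... | e∈I , e∈pre = subst (_∈ C′) (old-injectiveOn sep (C⊆I s∈C) e∈I (old-section C′ (old e))) s∈C
      where
      s∈C : section C′ (old e) ∈ C′
      s∈C = section-∈ (∈-preimage⁻ e∈pre)
    from : C′ ⊆ I′ ∩ preimage (image C′)
    from e∈C = x∈p∩q⁺ (C⊆I e∈C , ∈-preimage⁺ (∈-image⁺ e∈C))

  matching-image : ∀ {r} {S : Fin n → Fin r → Set} {X′} → Matching (S ∘ old) X′ → Matching S (image X′)
  matching-image {S = S} {X′} = matching-map {S = S} old (section X′) section-∈ (old-section X′)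

  matching-preimage : ∀ {r} {S : Fin n → Fin r → Set} {X′} → Separated X′ → Matching S (image X′) → Matching (S ∘ old) X′
  matching-preimage {S = S} sep = matching-comap {S = S} old ∈-image⁺ (old-injectiveOn sep)

module AddParallel (G : Graph) (f g : Fin (nE G)) (g∥f : SameEnds G g f) where

  open Relabel g

  G′ : Graph
  G′ = addParallel G f

  incident-old : ∀ {v} e → Incident G′ v e → Incident G v (old e)
  incident-old zero    = incident-sameEnds G (sameEnds-sym G g∥f)
  incident-old (suc e) = id

  incident-old⁻ : ∀ {v} e → Incident G v (old e) → Incident G′ v e
  incident-old⁻ zero    = incident-sameEnds G g∥f
  incident-old⁻ (suc e) = id

  deg-image : ∀ {X′} → Separated X′ → ∀ v → deg G′ X′ v ≡ deg G (image X′) v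
  deg-image {b ∷ X} sep v = trans (deg≡∑ G′ (b ∷ X) v) (trans (cong (weight G′ (b ∷ X) v zero +_) (sym (deg≡∑ G X v))) (split b sep))
    where
    split : ∀ b → Separated (b ∷ X) → weight G′ (b ∷ X) v zero + deg G X v ≡ deg G (image (b ∷ X)) v
    split false _   = refl
    split true  sep = begin
      endCount G v f + deg G X v        ≡⟨ cong (_+ deg G X v) (endCount-sameEnds G (sameEnds-sym G g∥f) v) ⟩
      endCount G v g + deg G X v        ≡⟨ cong (_+ deg G X v) (sym (deg-⁅⁆ G g v)) ⟩
      deg G ⁅ g ⁆ v + deg G X v         ≡⟨ sym (deg-∪ G (λ x∈g x∈X → sep here (there (subst (_∈ X) (x∈⁅y⁆⇒x≡y g x∈g) x∈X))) v) ⟩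
      deg G (⁅ g ⁆ ∪ X) v               ∎
      where open ≡-Reasoning

  reach-image-edge : ∀ {X′ e} → e ∈ X′ → Reach G (image X′) (end₁ G′ e) (end₂ G′ e)
  reach-image-edge {e = zero}  z∈X = reach-sameEnds G (sameEnds-sym G g∥f) (∈-image⁺ z∈X)
  reach-image-edge {e = suc e} e∈X = reach-edge G (∈-image⁺ e∈X)

  reach-image : ∀ {X′ u w} → Reach G′ X′ u w → Reach G (image X′) u w
  reach-image here                = here
  reach-image (step₁ e x refl r) = reach-trans G (reach-image-edge x) (reach-image r)
  reach-image (step₂ e x refl r) = reach-trans G (reach-sym G (reach-image-edge x)) (reach-image r)

  reach-old-edge : ∀ {X′} e → e ∈ X′ → Reach G′ X′ (end₁ G (old e)) (end₂ G (old e))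
  -- The new edge zero of G′ has the ends of f, so g∥f is literally SameEnds G′ (suc g) zero.
  reach-old-edge zero    z∈X = reach-sameEnds G′ {a = suc g} {b = zero} g∥f z∈X
  reach-old-edge (suc e) e∈X = reach-edge G′ e∈X

  reach-preimage-edge : ∀ {X′ e} → e ∈ image X′ → Reach G′ X′ (end₁ G e) (end₂ G e)
  reach-preimage-edge {X′} {e} e∈X = subst (λ x → Reach G′ X′ (end₁ G x) (end₂ G x)) (old-section X′ e)
    (reach-old-edge (section X′ e) (section-∈ e∈X))

  reach-preimage : ∀ {X′ u w} → Reach G (image X′) u w → Reach G′ X′ u w
  reach-preimage here                = here
  reach-preimage (step₁ e x refl r) = reach-trans G′ (reach-preimage-edge x) (reach-preimage r)
  reach-preimage (step₂ e x refl r) = reach-trans G′ (reach-sym G′ (reach-preimage-edge x)) (reach-preimage r)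

  reach-old : ∀ {X′ e} → e ∈ X′ → Reach G′ X′ (end₁ G′ e) (end₁ G (old e))
  reach-old {e = zero}  z∈X = reach-end₁-sameEnds G′ {a = suc g} {b = zero} g∥f z∈X
  reach-old {e = suc e} e∈X = here

  isCycle-image : ∀ {X′} → Separated X′ → IsCycle G′ X′ → IsCycle G (image X′)
  isCycle-image {X′} sep ((e , e∈X) , degree-two , connected) = (old e , ∈-image⁺ e∈X) , degree-two′ , connected′
    where
    s∈X : ∀ {x} → x ∈ image X′ → section X′ x ∈ X′
    s∈X = section-∈
    degree-two′ : ∀ v x → x ∈ image X′ → Incident G v x → deg G (image X′) v ≡ 2
    degree-two′ v x x∈X inc = trans (sym (deg-image sep v)) (degree-two v (section X′ x) (s∈X x∈X)
      (incident-old⁻ (section X′ x) (subst (Incident G v) (sym (old-section X′ x)) inc)))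
    to-old : ∀ {x} → (x∈X : x ∈ image X′) → Reach G (image X′) (end₁ G′ (section X′ x)) (end₁ G x)
    to-old {x} x∈X = subst (Reach G (image X′) (end₁ G′ (section X′ x)) ∘ end₁ G) (old-section X′ x) (reach-image (reach-old (s∈X x∈X)))
    connected′ : ∀ x y → x ∈ image X′ → y ∈ image X′ → Reach G (image X′) (end₁ G x) (end₁ G y)
    connected′ x y x∈X y∈X = reach-trans G (reach-sym G (to-old x∈X))
      (reach-trans G (reach-image (connected _ _ (s∈X x∈X) (s∈X y∈X))) (to-old y∈X))

  isCycle-preimage : ∀ {X′} → Separated X′ → IsCycle G (image X′) → IsCycle G′ X′
  isCycle-preimage {X′} sep ((e , e∈X) , degree-two , connected) = (section X′ e , section-∈ e∈X) , degree-two′ , connected′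
    where
    degree-two′ : ∀ v x → x ∈ X′ → Incident G′ v x → deg G′ X′ v ≡ 2
    degree-two′ v x x∈X inc = trans (deg-image sep v)
      (degree-two v (old x) (∈-image⁺ x∈X) (incident-old x inc))
    connected′ : ∀ x y → x ∈ X′ → y ∈ X′ → Reach G′ X′ (end₁ G′ x) (end₁ G′ y)
    connected′ x y x∈X y∈X = reach-trans G′ (reach-old x∈X)
      (reach-trans G′ (reach-preimage (connected _ _ (∈-image⁺ x∈X) (∈-image⁺ y∈X))) (reach-sym G′ (reach-old y∈X)))

  bicircIndep-image : ∀ {I′} → Separated I′ → BicircIndep G′ I′ → BicircIndep G (image I′)
  bicircIndep-image {I′} sep indep C D C⊆I D⊆I C-cyc D-cyc (e , e′ , e∈C , e′∈D , r) =
    trans (sym (image-restrict {I′} C⊆I)) (trans (cong image C′≡D′) (image-restrict {I′} D⊆I))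
    where
    restrict-⊆ : ∀ X → I′ ∩ preimage X ⊆ I′
    restrict-⊆ X = proj₁ ∘ x∈p∩q⁻ I′ (preimage X)
    lift-cycle : ∀ {X} → X ⊆ image I′ → IsCycle G X → IsCycle G′ (I′ ∩ preimage X)
    lift-cycle {X} X⊆I X-cyc = isCycle-preimage (separated-mono (restrict-⊆ X) sep)
      (subst (IsCycle G) (sym (image-restrict {I′} X⊆I)) X-cyc)
    lift-∈ : ∀ {X x} → X ⊆ image I′ → x ∈ X → section (I′ ∩ preimage X) x ∈ I′ ∩ preimage X
    lift-∈ X⊆I x∈X = section-∈ (subst (_ ∈_) (sym (image-restrict {I′} X⊆I)) x∈X)
    lift-reach : ∀ {X x} → X ⊆ image I′ → x ∈ X → Reach G′ I′ (end₁ G′ (section (I′ ∩ preimage X) x)) (end₁ G x)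
    lift-reach {X} {x} X⊆I x∈X = subst (λ y → Reach G′ I′ (end₁ G′ (section (I′ ∩ preimage X) x)) (end₁ G y)) (old-section (I′ ∩ preimage X) x)
      (reach-old (restrict-⊆ X (lift-∈ X⊆I x∈X)))
    C′≡D′ : I′ ∩ preimage C ≡ I′ ∩ preimage D
    C′≡D′ = indep _ _ (restrict-⊆ C) (restrict-⊆ D) (lift-cycle C⊆I C-cyc) (lift-cycle D⊆I D-cyc)
      (_ , _ , lift-∈ C⊆I e∈C , lift-∈ D⊆I e′∈D ,
       reach-trans G′ (lift-reach C⊆I e∈C) (reach-trans G′ (reach-preimage r) (reach-sym G′ (lift-reach D⊆I e′∈D))))

  bicircIndep-preimage : ∀ {I′} → Separated I′ → BicircIndep G (image I′) → BicircIndep G′ I′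
  bicircIndep-preimage {I′} sep indep C′ D′ C⊆I D⊆I C-cyc D-cyc (x , y , x∈C , y∈D , r) =
    trans (sym (restrict-image sep C⊆I)) (trans (cong (λ X → I′ ∩ preimage X) imC≡imD) (restrict-image sep D⊆I))
    where
    imC≡imD : image C′ ≡ image D′
    imC≡imD = indep _ _ (image-mono C⊆I) (image-mono D⊆I)
      (isCycle-image (separated-mono C⊆I sep) C-cyc) (isCycle-image (separated-mono D⊆I sep) D-cyc)
      (old x , old y , ∈-image⁺ x∈C , ∈-image⁺ y∈D ,
       reach-image (reach-trans G′ (reach-sym G′ (reach-old (C⊆I x∈C))) (reach-trans G′ r (reach-old (D⊆I y∈D)))))

-- Three sets with pairwise but no joint distinct representatives

module _ {r : ℕ} where

  OneOf : Fin r → Fin r → Fin r → Set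
  OneOf a b l = l ≡ a ⊎ l ≡ b

  oneOf-≢ˡ : ∀ {a b l} → OneOf a b l → l ≢ a → l ≡ b
  oneOf-≢ˡ (inj₁ l≡a) l≢a = ⊥-elim (l≢a l≡a)
  oneOf-≢ˡ (inj₂ l≡b) _   = l≡b

  oneOf-≢ʳ : ∀ {a b l} → OneOf a b l → l ≢ b → l ≡ a
  oneOf-≢ʳ (inj₁ l≡a) _   = l≡a
  oneOf-≢ʳ (inj₂ l≡b) l≢b = ⊥-elim (l≢b l≡b)

  oneOf-third : ∀ {a b x y l} → OneOf a b x → OneOf a b y → OneOf a b l → x ≢ y → l ≢ y → l ≡ x
  oneOf-third (inj₁ refl) _           (inj₁ refl) _   _   = refl
  oneOf-third (inj₂ refl) _           (inj₂ refl) _   _   = refl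
  oneOf-third (inj₁ refl) (inj₁ refl) (inj₂ refl) x≢y _   = ⊥-elim (x≢y refl)
  oneOf-third (inj₁ refl) (inj₂ refl) (inj₂ refl) _   l≢y = ⊥-elim (l≢y refl)
  oneOf-third (inj₂ refl) (inj₂ refl) (inj₁ refl) x≢y _   = ⊥-elim (x≢y refl)
  oneOf-third (inj₂ refl) (inj₁ refl) (inj₁ refl) _   l≢y = ⊥-elim (l≢y refl)

  DistinctPair : (P Q : Fin r → Set) → Set
  DistinctPair P Q = ∃[ a ] ∃[ b ] P a × Q b × a ≢ b

  DistinctTriple : (P Q R : Fin r → Set) → Set
  DistinctTriple P Q R = ∃[ a ] ∃[ b ] ∃[ c ] P a × Q b × R c × a ≢ b × a ≢ c × b ≢ c

  module _ {P Q R : Fin r → Set} (no-triple : ¬ DistinctTriple P Q R) {a b} (Pa : P a) (Qb : Q b) (a≢b : a ≢ b) where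

    third-covered : ∀ {l} → R l → OneOf a b l
    third-covered {l} Rl with l ≟ a | l ≟ b
    ... | yes l≡a | _       = inj₁ l≡a
    ... | no  _   | yes l≡b = inj₂ l≡b
    ... | no  l≢a | no  l≢b = ⊥-elim (no-triple (a , b , l , Pa , Qb , Rl , a≢b , l≢a ∘ sym , l≢b ∘ sym))

    first-covered : DistinctPair Q R → ∀ {l} → P l → OneOf a b l
    first-covered (e , h , Qe , Rh , e≢h) {l} Pl with l ≟ a | l ≟ b
    ... | yes l≡a | _       = inj₁ l≡a
    ... | no  _   | yes l≡b = inj₂ l≡b
    ... | no  l≢a | no  l≢b with l ≟ e | third-covered Rh
    ...   | no  l≢e  | h∈ab      = ⊥-elim (no-triple (l , e , h , Pl , Qe , Rh , l≢e , l≢h , e≢h))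
      where
      l≢h : l ≢ h
      l≢h l≡h = [ l≢a , l≢b ] (subst (OneOf a b) (sym l≡h) h∈ab)
    ...   | yes refl | inj₁ refl = ⊥-elim (no-triple (l , b , h , Pl , Qb , Rh , l≢b , l≢a , a≢b ∘ sym))
    ...   | yes refl | inj₂ refl = ⊥-elim (no-triple (a , l , h , Pa , Qe , Rh , l≢a ∘ sym , a≢b , l≢b))

  record TwoPointUnion (P₁ P₂ P₃ : Fin r → Set) : Set where
    field
      j k  : Fin r
      j≢k  : j ≢ k
      ⊆₁   : ∀ {l} → P₁ l → OneOf j k l
      ⊆₂   : ∀ {l} → P₂ l → OneOf j k l
      ⊆₃   : ∀ {l} → P₃ l → OneOf j k l
      full : (P₁ j × P₁ k) ⊎ (P₂ j × P₂ k) ⊎ (P₃ j × P₃ k)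

  two-point-union : ∀ {P₁ P₂ P₃} → Decidable P₁ → Decidable P₂ →
                    DistinctPair P₁ P₂ → DistinctPair P₁ P₃ → DistinctPair P₂ P₃ → ¬ DistinctTriple P₁ P₂ P₃ →
                    TwoPointUnion P₁ P₂ P₃
  two-point-union {P₁} {P₂} {P₃} P₁? P₂? (a , b , P₁a , P₂b , a≢b) p₁₃@(c , d , P₁c , P₃d , c≢d) p₂₃@(e , h , P₂e , P₃h , e≢h)
    no-triple = record { j = a ; k = b ; j≢k = a≢b ; ⊆₁ = ⊆₁ ; ⊆₂ = ⊆₂ ; ⊆₃ = ⊆₃ ; full = full }
    where
    ⊆₁ : ∀ {l} → P₁ l → OneOf a b l
    ⊆₁ = first-covered no-triple P₁a P₂b a≢b p₂₃
    ⊆₂ : ∀ {l} → P₂ l → OneOf a b l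
    ⊆₂ = Sum.swap ∘ first-covered no-triple′ P₂b P₁a (a≢b ∘ sym) p₁₃
      where
      no-triple′ : ¬ DistinctTriple P₂ P₁ P₃
      no-triple′ (x , y , z , P₂x , P₁y , P₃z , x≢y , x≢z , y≢z) =
        no-triple (y , x , z , P₁y , P₂x , P₃z , x≢y ∘ sym , y≢z , x≢z)
    ⊆₃ : ∀ {l} → P₃ l → OneOf a b l
    ⊆₃ = third-covered no-triple P₁a P₂b a≢b
    full : (P₁ a × P₁ b) ⊎ (P₂ a × P₂ b) ⊎ (P₃ a × P₃ b)
    full with P₁? b | P₂? a
    ... | yes P₁b | _       = inj₁ (P₁a , P₁b)
    ... | no  _   | yes P₂a = inj₂ (inj₁ (P₂a , P₂b))
    ... | no ¬P₁b | no ¬P₂a = inj₂ (inj₂ (subst P₃ h≡a P₃h , subst P₃ d≡b P₃d))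
      where
      c≡a : c ≡ a
      c≡a = oneOf-≢ʳ (⊆₁ P₁c) (λ c≡b → ¬P₁b (subst P₁ c≡b P₁c))
      d≡b : d ≡ b
      d≡b = oneOf-≢ˡ (⊆₃ P₃d) (λ d≡a → c≢d (trans c≡a (sym d≡a)))
      e≡b : e ≡ b
      e≡b = oneOf-≢ˡ (⊆₂ P₂e) (λ e≡a → ¬P₂a (subst P₂ e≡a P₂e))
      h≡a : h ≡ a
      h≡a = oneOf-≢ʳ (⊆₃ P₃h) (λ h≡b → e≢h (trans e≡b (sym h≡b)))

-- Doubling a position of the interval ordering

punchIn-suc-self : ∀ {n} (t : Fin n) → punchIn (suc t) t ≡ inject₁ t
punchIn-suc-self zero    = refl
punchIn-suc-self (suc t) = cong suc (punchIn-suc-self t)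

punchIn-inject₁-self : ∀ {n} (t : Fin n) → punchIn (inject₁ t) t ≡ suc t
punchIn-inject₁-self zero    = refl
punchIn-inject₁-self (suc t) = cong suc (punchIn-inject₁-self t)

punchIn-suc≡punchIn-inject₁ : ∀ {n} {t x : Fin n} → x ≢ t → punchIn (suc t) x ≡ punchIn (inject₁ t) x
punchIn-suc≡punchIn-inject₁ {t = zero}  {zero}  x≢t = ⊥-elim (x≢t refl)
punchIn-suc≡punchIn-inject₁ {t = zero}  {suc x} x≢t = refl
punchIn-suc≡punchIn-inject₁ {t = suc t} {zero}  x≢t = refl
punchIn-suc≡punchIn-inject₁ {t = suc t} {suc x} x≢t = cong suc (punchIn-suc≡punchIn-inject₁ (x≢t ∘ cong suc))

punchIn-suc≤punchIn-inject₁ : ∀ {n} (t x : Fin n) → punchIn (suc t) x ≤ punchIn (inject₁ t) x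
punchIn-suc≤punchIn-inject₁ zero    zero    = z≤n
punchIn-suc≤punchIn-inject₁ zero    (suc x) = ℕ.≤-refl
punchIn-suc≤punchIn-inject₁ (suc t) zero    = z≤n
punchIn-suc≤punchIn-inject₁ (suc t) (suc x) = s≤s (punchIn-suc≤punchIn-inject₁ t x)

punchIn-suc≤suc⁻ : ∀ {n} (t x : Fin n) → punchIn (suc t) x ≤ suc t → x ≤ t
punchIn-suc≤suc⁻ zero    zero    _         = z≤n
punchIn-suc≤suc⁻ zero    (suc x) (s≤s ())
punchIn-suc≤suc⁻ (suc t) zero    _         = z≤n
punchIn-suc≤suc⁻ (suc t) (suc x) (s≤s le) = s≤s (punchIn-suc≤suc⁻ t x le)

inject₁≤punchIn-inject₁⁻ : ∀ {n} (t x : Fin n) → inject₁ t ≤ punchIn (inject₁ t) x → t ≤ x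
inject₁≤punchIn-inject₁⁻ zero    x       _         = z≤n
inject₁≤punchIn-inject₁⁻ (suc t) (suc x) (s≤s le) = s≤s (inject₁≤punchIn-inject₁⁻ t x le)

-- Position t is split into inject₁ t and suc t; the lower end of an interval is moved
-- as if t were its lower copy and the upper end as if t were its upper copy, so that an
-- interval contains both copies of t exactly when it contained t.
module Doubling {n} (t : Fin n) where

  double : Interval n → Interval (suc n)
  double (L , H) = punchIn (suc t) L , punchIn (inject₁ t) H

  IsCopy : Fin (suc n) → Set
  IsCopy y = y ≡ inject₁ t ⊎ y ≡ suc t

  punchIn-copy : ∀ {p} → IsCopy p → IsCopy (punchIn p t)
  punchIn-copy (inj₁ refl) = inj₂ (punchIn-inject₁-self t)
  punchIn-copy (inj₂ refl) = inj₁ (punchIn-suc-self t)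

  punchIn-copy-≢ : ∀ {p x} → IsCopy p → x ≢ t → punchIn p x ≡ punchIn (suc t) x
  punchIn-copy-≢ (inj₁ refl) x≢t = sym (punchIn-suc≡punchIn-inject₁ x≢t)
  punchIn-copy-≢ (inj₂ refl) x≢t = refl

  ∈-double : ∀ {x A} → x ≢ t → punchIn (suc t) x ∈ᴵ double A ⇔ x ∈ᴵ A
  ∈-double {x} {L , H} x≢t = mk⇔
    (λ (L≤x , x≤H) → punchIn-cancel-≤ (suc t) L x L≤x ,
                     punchIn-cancel-≤ (inject₁ t) x H (subst (_≤ punchIn (inject₁ t) H) (punchIn-suc≡punchIn-inject₁ x≢t) x≤H))
    (λ (L≤x , x≤H) → punchIn-mono-≤ (suc t) L x L≤x ,
                     subst (_≤ punchIn (inject₁ t) H) (sym (punchIn-suc≡punchIn-inject₁ x≢t)) (punchIn-mono-≤ (inject₁ t) x H x≤H))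

  ∈-double-copy : ∀ {y A} → IsCopy y → y ∈ᴵ double A ⇔ t ∈ᴵ A
  ∈-double-copy {A = L , H} (inj₁ refl) = mk⇔
    (λ (L≤t , t≤H) → punchIn-cancel-≤ (suc t) L t (subst (punchIn (suc t) L ≤_) (sym (punchIn-suc-self t)) L≤t) ,
                     inject₁≤punchIn-inject₁⁻ t H t≤H)
    (λ (L≤t , t≤H) → subst (punchIn (suc t) L ≤_) (punchIn-suc-self t) (punchIn-mono-≤ (suc t) L t L≤t) ,
                     subst (_≤ punchIn (inject₁ t) H) (punchIn-suc-self t)
                       (≤-trans (punchIn-suc≤punchIn-inject₁ t t) (punchIn-mono-≤ (inject₁ t) t H t≤H)))
  ∈-double-copy {A = L , H} (inj₂ refl) = mk⇔
    (λ (L≤t , t≤H) → punchIn-suc≤suc⁻ t L L≤t ,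
                     punchIn-cancel-≤ (inject₁ t) t H (subst (_≤ punchIn (inject₁ t) H) (sym (punchIn-inject₁-self t)) t≤H))
    (λ (L≤t , t≤H) → subst (punchIn (suc t) L ≤_) (punchIn-inject₁-self t)
                       (≤-trans (punchIn-mono-≤ (suc t) L t L≤t) (punchIn-suc≤punchIn-inject₁ t t)) ,
                     subst (_≤ punchIn (inject₁ t) H) (punchIn-inject₁-self t) (punchIn-mono-≤ (inject₁ t) t H t≤H))

  double-nonempty : ∀ {L H} → L ≤ H → proj₁ (double (L , H)) ≤ proj₂ (double (L , H))
  double-nonempty {L} {H} L≤H = ≤-trans (punchIn-suc≤punchIn-inject₁ t L) (punchIn-mono-≤ (inject₁ t) L H L≤H)

  double-⊆ᴵ⁻ : ∀ {A B} → double A ⊆ᴵ double B → A ⊆ᴵ B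
  double-⊆ᴵ⁻ {L , H} {L′ , H′} (L′≤L , H≤H′) = punchIn-cancel-≤ (suc t) L′ L L′≤L , punchIn-cancel-≤ (inject₁ t) H H′ H≤H′

module ThreeParallelEdges (G : Graph) (f₁ f₂ f₃ : Fin (nE G))
  (f₁≢f₂ : f₁ ≢ f₂) (f₁≢f₃ : f₁ ≢ f₃) (f₂≢f₃ : f₂ ≢ f₃)
  (f₁∥f₂ : Parallel G f₁ f₂) (f₁∥f₃ : Parallel G f₁ f₃) (f₂∥f₃ : Parallel G f₂ f₃) where

  private
    n : ℕ
    n = nE G
    module R = Relabel

  G′ : Graph
  G′ = addParallel G f₁

  Among : Fin n → Set
  Among g = g ≡ f₁ ⊎ g ≡ f₂ ⊎ g ≡ f₃

  among-∥f₁ : ∀ {g} → Among g → SameEnds G g f₁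
  among-∥f₁ (inj₁ refl)        = inj₁ refl
  among-∥f₁ (inj₂ (inj₁ refl)) = sameEnds-sym G (proj₂ (proj₂ f₁∥f₂))
  among-∥f₁ (inj₂ (inj₂ refl)) = sameEnds-sym G (proj₂ (proj₂ f₁∥f₃))

  bicircIndep⇔image : ∀ {g I′} → Among g → R.Separated g I′ → BicircIndep G′ I′ ⇔ BicircIndep G (R.image g I′)
  bicircIndep⇔image {g} among sep = mk⇔ (bicircIndep-image sep) (bicircIndep-preimage sep)
    where open AddParallel G f₁ g (among-∥f₁ among)

  all-¬bicircIndep : ∀ {I} → f₁ ∈ I → f₂ ∈ I → f₃ ∈ I → ¬ BicircIndep G I
  all-¬bicircIndep = triple-¬bicircIndep G f₁≢f₂ f₁≢f₃ f₂≢f₃ f₁∥f₂ f₁∥f₃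

  module WithIntervalOrdering (σ : Fin n ↔ Fin n) (r : ℕ) (A : Fin r → Interval n)
    (presents : ∀ I → (BicircIndep G I → PartialTransversal (Inverse.to σ) A I)
                    × (PartialTransversal (Inverse.to σ) A I → BicircIndep G I)) where

    Fits : Fin n → Fin r → Set
    Fits e j = Inverse.to σ e ∈ᴵ A j

    fits? : ∀ e → Decidable (Fits e)
    fits? e j = (proj₁ (A j) ≤? Inverse.to σ e) ×-dec (Inverse.to σ e ≤? proj₂ (A j))

    bicircIndep⇔matching : ∀ I → BicircIndep G I ⇔ Matching Fits I
    bicircIndep⇔matching I = mk⇔ (proj₁ (presents I)) (proj₂ (presents I))

    distinct-pair : ∀ {a b} → Parallel G a b → a ≢ b → DistinctPair (Fits a) (Fits b)
    distinct-pair {a} {b} a∥b a≢b with Equivalence.to (bicircIndep⇔matching _) (pair-bicircIndep G a∥b)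
    ... | φ , matched , injective =
      φ a , φ b , matched a (∈-pair⁺ˡ a b) , matched b (∈-pair⁺ʳ a b) , a≢b ∘ injective a b (∈-pair⁺ˡ a b) (∈-pair⁺ʳ a b)

    no-distinct-triple : ¬ DistinctTriple (Fits f₁) (Fits f₂) (Fits f₃)
    no-distinct-triple (_ , _ , _ , F₁ , F₂ , F₃ , p≢q , p≢s , q≢s) =
      all-¬bicircIndep (∈-triple⁺ (inj₁ refl)) (∈-triple⁺ (inj₂ (inj₁ refl))) (∈-triple⁺ (inj₂ (inj₂ refl)))
        (Equivalence.from (bicircIndep⇔matching _) (triple-matching {R = Fits} f₁≢f₂ f₁≢f₃ f₂≢f₃ F₁ F₂ F₃ p≢q p≢s q≢s))

    open TwoPointUnion (two-point-union (fits? f₁) (fits? f₂)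
      (distinct-pair f₁∥f₂ f₁≢f₂) (distinct-pair f₁∥f₃ f₁≢f₃) (distinct-pair f₂∥f₃ f₂≢f₃) no-distinct-triple)

    covered : ∀ {g} → Among g → ∀ {l} → Fits g l → OneOf j k l
    covered (inj₁ refl)        = ⊆₁
    covered (inj₂ (inj₁ refl)) = ⊆₂
    covered (inj₂ (inj₂ refl)) = ⊆₃

    fits-somewhere : ∀ {g} → Among g → ∃[ l ] Fits g l
    fits-somewhere (inj₁ refl)        = let (l , _ , F , _) = distinct-pair f₁∥f₂ f₁≢f₂ in l , F
    fits-somewhere (inj₂ (inj₁ refl)) = let (_ , l , _ , F , _) = distinct-pair f₁∥f₂ f₁≢f₂ in l , F
    fits-somewhere (inj₂ (inj₂ refl)) = let (_ , l , _ , F , _) = distinct-pair f₁∥f₃ f₁≢f₃ in l , F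

    pivot-spec : ∃[ g ] Among g × Fits g j × Fits g k
    pivot-spec = spanning full
      where
      spanning : (Fits f₁ j × Fits f₁ k) ⊎ (Fits f₂ j × Fits f₂ k) ⊎ (Fits f₃ j × Fits f₃ k) → ∃[ g ] Among g × Fits g j × Fits g k
      spanning (inj₁ F₁)        = f₁ , inj₁ refl , F₁
      spanning (inj₂ (inj₁ F₂)) = f₂ , inj₂ (inj₁ refl) , F₂
      spanning (inj₂ (inj₂ F₃)) = f₃ , inj₂ (inj₂ refl) , F₃

    pivot : Fin n
    pivot = proj₁ pivot-spec

    pivot-among : Among pivot
    pivot-among = proj₁ (proj₂ pivot-spec)

    dominated : ∀ {g l} → Among g → Fits g l → Fits pivot l
    dominated among F with covered among F
    ... | inj₁ refl = proj₁ (proj₂ (proj₂ pivot-spec))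
    ... | inj₂ refl = proj₂ (proj₂ (proj₂ pivot-spec))

    FitsNew : Fin (suc n) → Fin r → Set
    FitsNew = Fits ∘ R.old pivot

    bicircIndep⇔matching-old : ∀ {g I′} → Among g → R.Separated g I′ → BicircIndep G′ I′ ⇔ Matching (Fits ∘ R.old g) I′
    bicircIndep⇔matching-old {g} {I′} among sep = begin
      BicircIndep G′ I′              ≈⟨ bicircIndep⇔image among sep ⟩
      BicircIndep G (R.image g I′)   ≈⟨ bicircIndep⇔matching _ ⟩
      Matching Fits (R.image g I′)   ≈⟨ mk⇔ (R.matching-preimage g {S = Fits} sep) (R.matching-image g {S = Fits}) ⟩
      Matching (Fits ∘ R.old g) I′   ∎
      where open SetoidReasoning (⇔-setoid 0ℓ)

    fits-old-≢zero : ∀ {g g′ z l} → z ≢ zero → Fits (R.old g z) l → Fits (R.old g′ z) l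
    fits-old-≢zero {z = zero}  z≢0 = ⊥-elim (z≢0 refl)
    fits-old-≢zero {z = suc _} _   = id

    matching-old⇔matchingNew : ∀ {g I} → Among g → pivot ∈ I → Matching (Fits ∘ R.old g) (true ∷ I) ⇔ Matching FitsNew (true ∷ I)
    matching-old⇔matchingNew {g} {I} among pivot∈I = mk⇔ (matching-weaken {R = Fits ∘ R.old g} to-pivot) from-pivot
      where
      to-pivot : ∀ {z l} → z ∈ true ∷ I → Fits (R.old g z) l → Fits (R.old pivot z) l
      to-pivot {zero}  _ = dominated among
      to-pivot {suc _} _ = id
      from-pivot : Matching FitsNew (true ∷ I) → Matching (Fits ∘ R.old g) (true ∷ I)
      from-pivot M@(φ , matched , injective) with fits? g (φ zero)
      ... | yes g-fits = matching-retarget {R = FitsNew} M g-fits (λ _ → fits-old-≢zero)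
      -- f sits at c and the pivot at a ≠ c, both among {j, k}; g fits somewhere in {j, k} but not at c.
      ... | no ¬g-fits = matching-exchange {R = FitsNew} M here (there pivot∈I) g-fits-a (matched zero here) (λ _ z≢0 _ → fits-old-≢zero z≢0)
        where
        a≢c : φ (suc pivot) ≢ φ zero
        a≢c eq with injective _ _ (there pivot∈I) here eq
        ... | ()
        g-fits-a : Fits g (φ (suc pivot))
        g-fits-a with fits-somewhere among
        ... | l , g-fits-l = subst (Fits g)
          (oneOf-third (covered pivot-among (matched (suc pivot) (there pivot∈I))) (covered pivot-among (matched zero here))
                       (covered among g-fits-l) a≢c (λ l≡c → ¬g-fits (subst (Fits g) l≡c g-fits-l)))
          g-fits-l

    bicircIndep⇔matchingNew-absent : ∀ {g I} → Among g → g ∉ I → pivot ∈ I → BicircIndep G′ (true ∷ I) ⇔ Matching FitsNew (true ∷ I)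
    bicircIndep⇔matchingNew-absent among g∉I pivot∈I = matching-old⇔matchingNew among pivot∈I ⇔-∘ bicircIndep⇔matching-old among (λ _ → g∉I ∘ drop-there)

    bicircIndep⇔matchingNew : ∀ I′ → BicircIndep G′ I′ ⇔ Matching FitsNew I′
    bicircIndep⇔matchingNew (false ∷ I) = bicircIndep⇔matching-old pivot-among (λ ())
    bicircIndep⇔matchingNew (true ∷ I) with pivot ∈? I
    ... | no pivot∉I = bicircIndep⇔matching-old pivot-among (λ _ → pivot∉I ∘ drop-there)
    ... | yes pivot∈I with f₁ ∈? I | f₂ ∈? I | f₃ ∈? I
    ...   | no f₁∉I | _       | _       = bicircIndep⇔matchingNew-absent (inj₁ refl) f₁∉I pivot∈I
    ...   | yes _   | no f₂∉I | _       = bicircIndep⇔matchingNew-absent (inj₂ (inj₁ refl)) f₂∉I pivot∈I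
    ...   | yes _   | yes _   | no f₃∉I = bicircIndep⇔matchingNew-absent (inj₂ (inj₂ refl)) f₃∉I pivot∈I
    ...   | yes f₁∈I | yes f₂∈I | yes f₃∈I = mk⇔
      (λ indep → ⊥-elim (¬indep (Equivalence.to (bicircIndep⇔image pivot-among (λ ())) (bicircIndep-mono G′ (out⊆ id) indep))))
      (λ M → ⊥-elim (¬indep (Equivalence.from (bicircIndep⇔matching I) (R.matching-image pivot {S = Fits} (matching-mono {R = FitsNew} (out⊆ id) M)))))
      where
      ¬indep : ¬ BicircIndep G I
      ¬indep = all-¬bicircIndep f₁∈I f₂∈I f₃∈I

    open Doubling (Inverse.to σ pivot)

    fits-inserted : ∀ {p} → IsCopy p → ∀ e′ j → Inverse.to (insert zero p σ) e′ ∈ᴵ double (A j) ⇔ FitsNew e′ j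
    fits-inserted p-copy zero    j = ∈-double-copy p-copy
    fits-inserted {p} p-copy (suc e) j with Inverse.to σ e ≟ Inverse.to σ pivot
    ... | yes σe≡t = subst (λ x → punchIn p x ∈ᴵ double (A j) ⇔ x ∈ᴵ A j) (sym σe≡t) (∈-double-copy (punchIn-copy p-copy))
    ... | no  σe≢t = subst (λ y → y ∈ᴵ double (A j) ⇔ Fits e j) (sym (punchIn-copy-≢ p-copy σe≢t)) (∈-double σe≢t)

    bicircIndep⇔transversal : ∀ {p} → IsCopy p → ∀ I′ →
      BicircIndep G′ I′ ⇔ PartialTransversal (Inverse.to (insert zero p σ)) (double ∘ A) I′
    bicircIndep⇔transversal p-copy I′ = mk⇔
      (matching-weaken (λ {e′} {j} _ → Equivalence.from (fits-inserted p-copy e′ j)) ∘ Equivalence.to (bicircIndep⇔matchingNew I′))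
      (Equivalence.from (bicircIndep⇔matchingNew I′) ∘ matching-weaken (λ {e′} {j} _ → Equivalence.to (fits-inserted p-copy e′ j)))

  extend : (σ : Fin n ↔ Fin n) → IsIntervalOrdering G σ →
           ∃[ g ] ∀ {p} → Doubling.IsCopy (Inverse.to σ g) p → IsIntervalOrdering G′ (insert zero p σ)
  extend σ (r , A , nonempty , incomparable , presents) =
    pivot , λ p-copy → r , double ∘ A , (λ i → double-nonempty (nonempty i)) ,
                       (λ i i′ i≢i′ → incomparable i i′ i≢i′ ∘ double-⊆ᴵ⁻) ,
                       (λ I′ → let e = bicircIndep⇔transversal p-copy I′ in Equivalence.to e , Equivalence.from e)
    where
    open WithIntervalOrdering σ r A presents
    open Doubling (Inverse.to σ pivot)

punchIn-suc≤suc : ∀ {n} {x t : Fin n} → x ≤ t → punchIn (suc t) x ≤ suc t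
punchIn-suc≤suc {t = t} x≤t =
  ≤-trans (punchIn-mono-≤ (suc t) _ t x≤t) (subst (_≤ suc t) (sym (punchIn-suc-self t)) (i≤inject₁[j]⇒i≤1+j ≤-refl))

inject₁≤punchIn-inject₁ : ∀ {n} {t x : Fin n} → t ≤ x → inject₁ t ≤ punchIn (inject₁ t) x
inject₁≤punchIn-inject₁ {t = t} {x = x} t≤x =
  ≤-trans (i≤inject₁[j]⇒i≤1+j ≤-refl) (subst (_≤ punchIn (inject₁ t) x) (punchIn-inject₁-self t) (punchIn-mono-≤ (inject₁ t) t x t≤x))

lemma8 : (G : Graph) (f₁ f₂ f₃ : Fin (nE G)) →
    f₁ ≢ f₂ → f₁ ≢ f₃ → f₂ ≢ f₃ →
    Parallel G f₁ f₂ → Parallel G f₁ f₃ → Parallel G f₂ f₃ →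
    (IsLatticePathBicircular G → IsLatticePathBicircular (addParallel G f₁))
    × (HasIntervalOrderingWithMin G f₁ → HasIntervalOrderingWithMin (addParallel G f₁) (suc f₁))
    × (HasIntervalOrderingWithMax G f₁ → HasIntervalOrderingWithMax (addParallel G f₁) (suc f₁))
lemma8 G f₁ f₂ f₃ f₁≢f₂ f₁≢f₃ f₂≢f₃ f₁∥f₂ f₁∥f₃ f₂∥f₃ = lattice-path , with-min , with-max
  where
  open ThreeParallelEdges G f₁ f₂ f₃ f₁≢f₂ f₁≢f₃ f₂≢f₃ f₁∥f₂ f₁∥f₃ f₂∥f₃

  lattice-path : IsLatticePathBicircular G → IsLatticePathBicircular G′
  lattice-path (σ , ordering) with extend σ ordering
  ... | g , extended = insert zero (suc (Inverse.to σ g)) σ , extended (inj₂ refl)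

  with-min : HasIntervalOrderingWithMin G f₁ → HasIntervalOrderingWithMin G′ (suc f₁)
  with-min (σ , ordering , minimal) with extend σ ordering
  ... | g , extended = insert zero (suc (Inverse.to σ g)) σ , extended (inj₂ refl) , minimal′
    where
    minimal′ : ∀ e′ → Inverse.to (insert zero (suc (Inverse.to σ g)) σ) (suc f₁) ≤ Inverse.to (insert zero (suc (Inverse.to σ g)) σ) e′
    minimal′ zero    = punchIn-suc≤suc (minimal g)
    minimal′ (suc e) = punchIn-mono-≤ _ _ _ (minimal e)

  with-max : HasIntervalOrderingWithMax G f₁ → HasIntervalOrderingWithMax G′ (suc f₁)
  with-max (σ , ordering , maximal) with extend σ ordering
  ... | g , extended = insert zero (inject₁ (Inverse.to σ g)) σ , extended (inj₁ refl) , maximal′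
    where
    maximal′ : ∀ e′ → Inverse.to (insert zero (inject₁ (Inverse.to σ g)) σ) e′ ≤ Inverse.to (insert zero (inject₁ (Inverse.to σ g)) σ) (suc f₁)
    maximal′ zero    = inject₁≤punchIn-inject₁ (maximal g)
    maximal′ (suc e) = punchIn-mono-≤ _ _ _ (maximal e)
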